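{- For every set $\Gamma$ of formulas and every formula $A$ of $LET_F$: if $\Gamma \vdash A$, then $\Gamma \models A$.
   Context: The language $\mathcal{L}$ of $LET_F$ has propositional letters $p_1,p_2,\dots$, unary connectives $\circ,\bullet,\neg$, binary $\wedge,\vee$. An $LET_F$-valuation is a function $v:\mathcal{L}\to\{0,1\}$ such that for all formulas $A,B$: (v1) $v(A\wedge B)=1$ iff $v(A)=1$ and $v(B)=1$; (v2) $v(A\vee B)=1$ iff $v(A)=1$ or $v(B)=1$; (v3) $v(\neg(A\wedge B))=1$ iff $v(\neg A)=1$ or $v(\neg B)=1$; (v4) $v(\neg(A\vee B))=1$ iff $v(\neg A)=1$ and $v(\neg B)=1$; (v5) $v(A)=1$ iff $v(\neg\neg A)=1$; (v6) if $v(\circ A)=1$ then ($v(A)=1$ iff $v(\neg A)=0$); (v7) $v(\bullet A)=1$ iff $v(\circ A)=0$. $\Gamma\models A$ means: for every $LET_F$-valuation $v$, if $v(B)=1$ for all $B\in\Gamma$ then $v(A)=1$. Tableau rules on signed formulas $1(F)$, $0(F)$ ("$\mid$" = branching): R1: $1(A\wedge B) \Rightarrow 1(A), 1(B)$. R2: $0(A\wedge B) \Rightarrow 0(A) \mid 0(B)$. R3: $1(\neg(A\wedge B)) \Rightarrow 1(\neg A) \mid 1(\neg B)$. R4: $0(\neg(A\wedge B)) \Rightarrow 0(\neg A), 0(\neg B)$. R5: $1(A\vee B) \Rightarrow 1(A) \mid 1(B)$. R6: $0(A\vee B) \Rightarrow 0(A), 0(B)$. R7: $1(\neg(A\vee B))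 \Rightarrow 1(\neg A), 1(\neg B)$. R8: $0(\neg(A\vee B)) \Rightarrow 0(\neg A) \mid 0(\neg B)$. R9: $1(\neg\neg A) \Rightarrow 1(A)$. R10: $0(\neg\neg A) \Rightarrow 0(A)$. R11: $1(\circ A) \Rightarrow 1(A), 0(\neg A) \mid 0(A), 1(\neg A)$. R12: $1(\bullet A) \Rightarrow 0(\circ A)$. R13: $0(\bullet A) \Rightarrow 1(\circ A)$. No other rules. A tableau for a set $\Delta$ of signed formulas is a tree whose first node contains $\Delta$ and whose further nodes arise by applying rules. A branch is closed if it contains $1(F)$ and $0(F)$ for some $F$; a tableau is closed if all branches are closed. $\Gamma\vdash A$ means there is a closed tableau for $\{1(B):B\in\Gamma\}\cup\{0(A)\}$. -}

module Defs where

open import Data.Nat using (ℕ)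
open import Data.Bool using (Bool; true; false)
open import Data.Sum using (_⊎_)
open import Data.Product using (_×_; Σ)
open import Function.Bundles using (_⇔_)
open import Relation.Binary.PropositionalEquality using (_≡_)

data Formula : Set where
  p   : ℕ → Formula
  ∘_  : Formula → Formula
  •_  : Formula → Formula
  ¬_  : Formula → Formula
  _∧_ : Formula → Formula → Formula
  _∨_ : Formula → Formula → Formula

infixr 6 _∧_
infixr 5 _∨_

-- LET_F-valuations v : L → {0,1}  (1 = true, 0 = false)

record IsValuation (v : Formula → Bool) : Set where
  field
    v1 : ∀ A B → (v (A ∧ B) ≡ true) ⇔ (v A ≡ true × v B ≡ true)
    v2 : ∀ A B → (v (A ∨ B) ≡ true) ⇔ (v A ≡ true ⊎ v B ≡ true)
    v3 : ∀ A B → (v (¬ (A ∧ B)) ≡ true) ⇔ (v (¬ A) ≡ true ⊎ v (¬ B) ≡ true)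
    v4 : ∀ A B → (v (¬ (A ∨ B)) ≡ true) ⇔ (v (¬ A) ≡ true × v (¬ B) ≡ true)
    v5 : ∀ A → (v A ≡ true) ⇔ (v (¬ ¬ A) ≡ true)
    v6 : ∀ A → v (∘ A) ≡ true → ((v A ≡ true) ⇔ (v (¬ A) ≡ false))
    v7 : ∀ A → (v (• A) ≡ true) ⇔ (v (∘ A) ≡ false)

FSet : Set₁
FSet = Formula → Set

_⊨_ : FSet → Formula → Set
Γ ⊨ A = ∀ (v : Formula → Bool) → IsValuation v →
        (∀ B → Γ B → v B ≡ true) → v A ≡ true

data Signed : Set where
  1[_] : Formula → Signed
  0[_] : Formula → Signed

-- A branch is the set of signed formulas occurring on it.
Branch : Set₁
Branch = Signed → Set

_⊕_ : Branch → Signed → Branch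
(b ⊕ s) x = b x ⊎ x ≡ s

_⊕_,_ : Branch → Signed → Signed → Branch
(b ⊕ s , t) x = b x ⊎ (x ≡ s ⊎ x ≡ t)

-- ClosedTableau b : there is a (finite) closed tableau extending the
-- branch b, obtained by applying rules R1–R13 to signed formulas
-- occurring on the branch, all of whose branches are closed.
data ClosedTableau (b : Branch) : Set₁ where
  close : ∀ F → b 1[ F ] → b 0[ F ] → ClosedTableau b
  R1  : ∀ A B → b 1[ A ∧ B ] → ClosedTableau (b ⊕ 1[ A ] , 1[ B ]) → ClosedTableau b
  R2  : ∀ A B → b 0[ A ∧ B ] → ClosedTableau (b ⊕ 0[ A ]) → ClosedTableau (b ⊕ 0[ B ]) → ClosedTableau b
  R3  : ∀ A B → b 1[ ¬ (A ∧ B) ] → ClosedTableau (b ⊕ 1[ ¬ A ]) → ClosedTableau (b ⊕ 1[ ¬ B ]) → ClosedTableau b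
  R4  : ∀ A B → b 0[ ¬ (A ∧ B) ] → ClosedTableau (b ⊕ 0[ ¬ A ] , 0[ ¬ B ]) → ClosedTableau b
  R5  : ∀ A B → b 1[ A ∨ B ] → ClosedTableau (b ⊕ 1[ A ]) → ClosedTableau (b ⊕ 1[ B ]) → ClosedTableau b
  R6  : ∀ A B → b 0[ A ∨ B ] → ClosedTableau (b ⊕ 0[ A ] , 0[ B ]) → ClosedTableau b
  R7  : ∀ A B → b 1[ ¬ (A ∨ B) ] → ClosedTableau (b ⊕ 1[ ¬ A ] , 1[ ¬ B ]) → ClosedTableau b
  R8  : ∀ A B → b 0[ ¬ (A ∨ B) ] → ClosedTableau (b ⊕ 0[ ¬ A ]) → ClosedTableau (b ⊕ 0[ ¬ B ]) → ClosedTableau b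
  R9  : ∀ A → b 1[ ¬ ¬ A ] → ClosedTableau (b ⊕ 1[ A ]) → ClosedTableau b
  R10 : ∀ A → b 0[ ¬ ¬ A ] → ClosedTableau (b ⊕ 0[ A ]) → ClosedTableau b
  R11 : ∀ A → b 1[ ∘ A ] → ClosedTableau (b ⊕ 1[ A ] , 0[ ¬ A ]) → ClosedTableau (b ⊕ 0[ A ] , 1[ ¬ A ]) → ClosedTableau b
  R12 : ∀ A → b 1[ • A ] → ClosedTableau (b ⊕ 0[ ∘ A ]) → ClosedTableau b
  R13 : ∀ A → b 0[ • A ] → ClosedTableau (b ⊕ 1[ ∘ A ]) → ClosedTableau b

data Initial (Γ : FSet) (A : Formula) : Branch where
  hyp  : ∀ B → Γ B → Initial Γ A 1[ B ]
  goal : Initial Γ A 0[ A ]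

_⊢_ : FSet → Formula → Set₁
Γ ⊢ A = ClosedTableau (Initial Γ A)

-- A valuation satisfying every hypothesis and falsifying the conclusion
-- satisfies the initial branch of the tableau. Each rule is locally sound:
-- a valuation satisfying a branch satisfies one of the branches the rule
-- produces. Following a satisfied branch down a closed tableau therefore
-- reaches a leaf containing both 1(F) and 0(F), which no valuation satisfies.
module Submission where

open import Defs
open import Data.Bool using (Bool; true; false; not)
open import Data.Bool.Properties using (not-¬; ¬-not)
open import Data.Empty using (⊥; ⊥-elim)
open import Data.Product using (_×_; _,_)
open import Data.Sum using (_⊎_; inj₁; inj₂; [_,_]′)
open import Function.Base using (_∘_)
open import Function.Bundles using (Equivalence)
open import Relation.Binary.PropositionalEquality using (_≡_; refl)

open Equivalence using (to; from)

contraposeᵇ : ∀ {x y a b : Bool} → (x ≡ a → y ≡ b) → y ≡ not b → x ≡ not a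
contraposeᵇ f y≡¬b = ¬-not λ x≡a → not-¬ (f x≡a) y≡¬b

false-of-both-true : ∀ {x y z : Bool} →
  (x ≡ true × y ≡ true → z ≡ true) → z ≡ false → x ≡ false ⊎ y ≡ false
false-of-both-true {false}         _ _   = inj₁ refl
false-of-both-true {true}  {false} _ _   = inj₂ refl
false-of-both-true {true}  {true}  f z≡f = ⊥-elim (not-¬ (f (refl , refl)) z≡f)

_⊩_ : (Formula → Bool) → Signed → Set
v ⊩ 1[ F ] = v F ≡ true
v ⊩ 0[ F ] = v F ≡ false

Satisfies : (Formula → Bool) → Branch → Set
Satisfies v b = ∀ {s} → b s → v ⊩ s

module _ {v : Formula → Bool} {b : Branch} (sat : Satisfies v b) where

  satisfies-⊕ : ∀ {s} → v ⊩ s → Satisfies v (b ⊕ s)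
  satisfies-⊕ _  (inj₁ bs)   = sat bs
  satisfies-⊕ vs (inj₂ refl) = vs

  satisfies-⊕₂ : ∀ {s t} → v ⊩ s → v ⊩ t → Satisfies v (_⊕_,_ b s t)
  satisfies-⊕₂ _  _  (inj₁ bs)          = sat bs
  satisfies-⊕₂ vs _  (inj₂ (inj₁ refl)) = vs
  satisfies-⊕₂ _  vt (inj₂ (inj₂ refl)) = vt

module _ {v : Formula → Bool} (isV : IsValuation v) where
  open IsValuation isV

  ∧-false : ∀ {A B} → v (A ∧ B) ≡ false → v A ≡ false ⊎ v B ≡ false
  ∧-false {A} {B} = false-of-both-true (from (v1 A B))

  ¬∧-false : ∀ {A B} → v (¬ (A ∧ B)) ≡ false → v (¬ A) ≡ false × v (¬ B) ≡ false
  ¬∧-false {A} {B} h = contraposeᵇ (from (v3 A B) ∘ inj₁) h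
                     , contraposeᵇ (from (v3 A B) ∘ inj₂) h

  ∨-false : ∀ {A B} → v (A ∨ B) ≡ false → v A ≡ false × v B ≡ false
  ∨-false {A} {B} h = contraposeᵇ (from (v2 A B) ∘ inj₁) h
                    , contraposeᵇ (from (v2 A B) ∘ inj₂) h

  ¬∨-false : ∀ {A B} → v (¬ (A ∨ B)) ≡ false → v (¬ A) ≡ false ⊎ v (¬ B) ≡ false
  ¬∨-false {A} {B} = false-of-both-true (from (v4 A B))

  ¬¬-false : ∀ {A} → v (¬ ¬ A) ≡ false → v A ≡ false
  ¬¬-false {A} = contraposeᵇ (to (v5 A))

  •-false : ∀ {A} → v (• A) ≡ false → v (∘ A) ≡ true
  •-false {A} = contraposeᵇ (from (v7 A))

  ∘-true : ∀ {A} → v (∘ A) ≡ true →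
           (v A ≡ true × v (¬ A) ≡ false) ⊎ (v A ≡ false × v (¬ A) ≡ true)
  ∘-true {A} h with v A in vA
  ... | true  = inj₁ (refl , to (v6 A h) vA)
  ... | false = inj₂ (refl , contraposeᵇ (from (v6 A h)) vA)

  closed-unsatisfiable : ∀ {b} → ClosedTableau b → Satisfies v b → ⊥
  closed-unsatisfiable (close F x y) sat = not-¬ (sat x) (sat y)
  closed-unsatisfiable (R1 A B x t) sat with to (v1 A B) (sat x)
  ... | a , c = closed-unsatisfiable t (satisfies-⊕₂ sat a c)
  closed-unsatisfiable (R2 A B x t u) sat =
    [ closed-unsatisfiable t ∘ satisfies-⊕ sat
    , closed-unsatisfiable u ∘ satisfies-⊕ sat ]′ (∧-false (sat x))
  closed-unsatisfiable (R3 A B x t u) sat =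
    [ closed-unsatisfiable t ∘ satisfies-⊕ sat
    , closed-unsatisfiable u ∘ satisfies-⊕ sat ]′ (to (v3 A B) (sat x))
  closed-unsatisfiable (R4 A B x t) sat with ¬∧-false (sat x)
  ... | a , c = closed-unsatisfiable t (satisfies-⊕₂ sat a c)
  closed-unsatisfiable (R5 A B x t u) sat =
    [ closed-unsatisfiable t ∘ satisfies-⊕ sat
    , closed-unsatisfiable u ∘ satisfies-⊕ sat ]′ (to (v2 A B) (sat x))
  closed-unsatisfiable (R6 A B x t) sat with ∨-false (sat x)
  ... | a , c = closed-unsatisfiable t (satisfies-⊕₂ sat a c)
  closed-unsatisfiable (R7 A B x t) sat with to (v4 A B) (sat x)
  ... | a , c = closed-unsatisfiable t (satisfies-⊕₂ sat a c)
  closed-unsatisfiable (R8 A B x t u) sat =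
    [ closed-unsatisfiable t ∘ satisfies-⊕ sat
    , closed-unsatisfiable u ∘ satisfies-⊕ sat ]′ (¬∨-false (sat x))
  closed-unsatisfiable (R9 A x t) sat =
    closed-unsatisfiable t (satisfies-⊕ sat (from (v5 A) (sat x)))
  closed-unsatisfiable (R10 A x t) sat =
    closed-unsatisfiable t (satisfies-⊕ sat (¬¬-false (sat x)))
  closed-unsatisfiable (R11 A x t u) sat with ∘-true (sat x)
  ... | inj₁ (a , c) = closed-unsatisfiable t (satisfies-⊕₂ sat a c)
  ... | inj₂ (a , c) = closed-unsatisfiable u (satisfies-⊕₂ sat a c)
  closed-unsatisfiable (R12 A x t) sat =
    closed-unsatisfiable t (satisfies-⊕ sat (to (v7 A) (sat x)))
  closed-unsatisfiable (R13 A x t) sat =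
    closed-unsatisfiable t (satisfies-⊕ sat (•-false (sat x)))

satisfies-initial : ∀ {Γ A v} → (∀ B → Γ B → v B ≡ true) → v A ≡ false →
                    Satisfies v (Initial Γ A)
satisfies-initial vΓ _  (hyp B ΓB) = vΓ B ΓB
satisfies-initial _  vA goal       = vA

theorem11 : (Γ : FSet) (A : Formula) → Γ ⊢ A → Γ ⊨ A
theorem11 Γ A tableau v isV vΓ =
  ¬-not λ vA≡false → closed-unsatisfiable isV tableau (satisfies-initial vΓ vA≡false)
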